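{- Let $U$ be a positive integer. For any nonnegative integer $A$, there exist $\Omega(2^{\sqrt{U}})$ distinct nondecreasing piecewise linear convex functions $\varphi:[1,U]^2\to[A,A+U]$ such that: the sets $\{p\in[1,\dots,U]^2 : \varphi(p)=A\}$ are pairwise distinct for distinct functions of the family, and each function takes value at least $A+1$ at all integer points of $[1,\dots,U]^2$ not in its set. Each of these functions is described as the pointwise maximum of $O(\sqrt{U})$ hyperplanes (affine functions).
   Context: $[1,U]$ denotes a real interval and $[1,\dots,U]$ denotes the set of integers $\{1,2,\dots,U\}$. A function on $[1,U]^2$ is nondecreasing if it is nondecreasing in each coordinate.
   Formalization: The hyperplanes have rational coefficients, and the range and monotonicity of each function are required at the points of $[1,U]^2$ with rational coordinates rather than at all real points. -}

module Defs where

open import Data.Nat using (ℕ)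
open import Data.Integer using (+_)
open import Data.Rational using (ℚ; _/_; _+_; _*_; _⊔_; _≤_)
open import Data.List.NonEmpty using (List⁺; foldr₁; map)
open import Data.Product using (_×_)
open import Relation.Binary.PropositionalEquality using (_≡_; _≢_)

⟦_⟧ : ℕ → ℚ
⟦ n ⟧ = + n / 1

record Affine : Set where
  constructor aff
  field
    a b c : ℚ

evalAff : Affine → ℚ → ℚ → ℚ
evalAff (aff a b c) x y = a * x + b * y + c

-- the function given as the pointwise maximum of a nonempty list of affine functions
-- (automatically convex and piecewise linear)
maxAff : List⁺ Affine → ℚ → ℚ → ℚ
maxAff hs x y = foldr₁ _⊔_ (map (λ h → evalAff h x y) hs)

InBox : ℕ → ℚ → ℚ → Set
InBox U x y = (⟦ 1 ⟧ ≤ x × x ≤ ⟦ U ⟧) × (⟦ 1 ⟧ ≤ y × y ≤ ⟦ U ⟧)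

InGrid : ℕ → ℕ → ℕ → Set
InGrid U i j = (1 Data.Nat.≤ i × i Data.Nat.≤ U) × (1 Data.Nat.≤ j × j Data.Nat.≤ U)

RangeOK : ℕ → ℕ → (ℚ → ℚ → ℚ) → Set
RangeOK U A φ = ∀ x y → InBox U x y → ⟦ A ⟧ ≤ φ x y × φ x y ≤ ⟦ A Data.Nat.+ U ⟧

Nondecreasing : ℕ → (ℚ → ℚ → ℚ) → Set
Nondecreasing U φ = ∀ x y x′ y′ → InBox U x y → InBox U x′ y′ →
  x ≤ x′ → y ≤ y′ → φ x y ≤ φ x′ y′

SameZeroSet : ℕ → ℕ → (ℚ → ℚ → ℚ) → (ℚ → ℚ → ℚ) → Set
SameZeroSet U A φ ψ = ∀ i j → InGrid U i j →
  (φ ⟦ i ⟧ ⟦ j ⟧ ≡ ⟦ A ⟧ → ψ ⟦ i ⟧ ⟦ j ⟧ ≡ ⟦ A ⟧) ×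
  (ψ ⟦ i ⟧ ⟦ j ⟧ ≡ ⟦ A ⟧ → φ ⟦ i ⟧ ⟦ j ⟧ ≡ ⟦ A ⟧)

GapOK : ℕ → ℕ → (ℚ → ℚ → ℚ) → Set
GapOK U A φ = ∀ i j → InGrid U i j →
  φ ⟦ i ⟧ ⟦ j ⟧ ≢ ⟦ A ⟧ → ⟦ A Data.Nat.+ 1 ⟧ ≤ φ ⟦ i ⟧ ⟦ j ⟧

-- Since 1 ≤ U < (s+1)², s = m + 1. For a bit vector β ∈ {0,1}^s let φ_β
-- be the maximum of the constant A and of the pieces (0 ≤ k ≤ m)
--     x + k y + A + 1 + 2km − (k+1)U − k² − β_k .
-- All coefficients are integers and all slopes are ≥ 0, so φ_β is nondecreasing, is
-- ≥ A, and takes integer values on the grid, hence jumps from A to at least A + 1.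
-- At the corner (U , U) the k-th piece equals A + 1 + m² − (m−k)² − β_k ≤ A + U.
-- At the witness point p_t = (U − t², U − 2(m−t)) it equals A + 1 − (k−t)² − β_k, so
-- φ_β(p_t) = A exactly when β_t = 1: the zero set of φ_β determines β.

module Submission where

open import Defs
import Data.Nat as ℕ

module IntegerFacts where
  open ℕ using (_∸_; z≤n; s≤s)
  open import Data.Integer
  open import Data.Integer.Properties
  open import Data.Integer.Tactic.RingSolver using (solve-∀)
  open import Data.Empty using (⊥-elim)
  open import Relation.Binary.PropositionalEquality

  square-nonNeg : ∀ d → 0ℤ ≤ d * d
  square-nonNeg +0       = +≤+ z≤n
  square-nonNeg +[1+ n ] = +≤+ z≤n
  square-nonNeg -[1+ n ] = +≤+ z≤n

  square-pos : ∀ d → d ≢ 0ℤ → 1ℤ ≤ d * d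
  square-pos +0       d≢0 = ⊥-elim (d≢0 refl)
  square-pos +[1+ n ] _   = +≤+ (s≤s z≤n)
  square-pos -[1+ n ] _   = +≤+ (s≤s z≤n)

  minus-nonNeg : ∀ a e → 0ℤ ≤ e → a - e ≤ a
  minus-nonNeg a e 0≤e = ≤-trans (+-monoʳ-≤ a (neg-mono-≤ 0≤e)) (≤-reflexive (+-identityʳ a))

  succ-minus-pos : ∀ a e → 1ℤ ≤ e → a + 1ℤ - e ≤ a
  succ-minus-pos a e 1≤e =
    ≤-trans (+-monoʳ-≤ (a + 1ℤ) (neg-mono-≤ 1≤e)) (≤-reflexive (cancel a))
    where
    cancel : ∀ a → a + 1ℤ - 1ℤ ≡ a
    cancel = solve-∀

  pos-∸ : ∀ {m n} → n ℕ.≤ m → + (m ∸ n) ≡ + m - + n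
  pos-∸ {m} {n} n≤m = sym (trans (m-n≡m⊖n m n) (⊖-≥ n≤m))

module Embedding where
  open import Data.Integer as ℤ using (ℤ; +_)
  import Data.Integer.Properties as ℤ
  open import Data.Integer.Tactic.RingSolver using (solve-∀)
  open import Data.Rational
  open import Data.Rational.Properties
  import Data.Rational.Unnormalised as ℚᵘ
  import Data.Rational.Unnormalised.Properties as ℚᵘ
  open import Relation.Binary.PropositionalEquality
  open import Relation.Binary.Reasoning.Setoid ℚᵘ.≃-setoid

  -- the ring embedding ℤ → ℚ; note ⟦ n ⟧ is definitionally ι (+ n)
  ι : ℤ → ℚ
  ι z = z / 1

  -- facts about ι are transported from the unnormalised representative z / 1
  private
    ιᵘ : ℤ → ℚᵘ.ℚᵘ
    ιᵘ z = ℚᵘ.mkℚᵘ z 0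

    toℚᵘ-ι : ∀ z → toℚᵘ (ι z) ℚᵘ.≃ ιᵘ z
    toℚᵘ-ι z = toℚᵘ-fromℚᵘ (ιᵘ z)

  ι-+ : ∀ a b → ι (a ℤ.+ b) ≡ ι a + ι b
  ι-+ a b = toℚᵘ-injective (begin
    toℚᵘ (ι (a ℤ.+ b))          ≈⟨ toℚᵘ-ι (a ℤ.+ b) ⟩
    ιᵘ (a ℤ.+ b)                ≈⟨ ℚᵘ.*≡* (sum a b) ⟩
    ιᵘ a ℚᵘ.+ ιᵘ b              ≈⟨ ℚᵘ.+-cong (ℚᵘ.≃-sym (toℚᵘ-ι a)) (ℚᵘ.≃-sym (toℚᵘ-ι b)) ⟩
    toℚᵘ (ι a) ℚᵘ.+ toℚᵘ (ι b)  ≈⟨ ℚᵘ.≃-sym (toℚᵘ-homo-+ (ι a) (ι b)) ⟩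
    toℚᵘ (ι a + ι b)            ∎)
    where
    sum : ∀ a b → (a ℤ.+ b) ℤ.* + 1 ≡ (a ℤ.* + 1 ℤ.+ b ℤ.* + 1) ℤ.* + 1
    sum = solve-∀

  ι-* : ∀ a b → ι (a ℤ.* b) ≡ ι a * ι b
  ι-* a b = toℚᵘ-injective (begin
    toℚᵘ (ι (a ℤ.* b))          ≈⟨ toℚᵘ-ι (a ℤ.* b) ⟩
    ιᵘ (a ℤ.* b)                ≈⟨ ℚᵘ.*≡* refl ⟩
    ιᵘ a ℚᵘ.* ιᵘ b              ≈⟨ ℚᵘ.*-cong (ℚᵘ.≃-sym (toℚᵘ-ι a)) (ℚᵘ.≃-sym (toℚᵘ-ι b)) ⟩
    toℚᵘ (ι a) ℚᵘ.* toℚᵘ (ι b)  ≈⟨ ℚᵘ.≃-sym (toℚᵘ-homo-* (ι a) (ι b)) ⟩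
    toℚᵘ (ι a * ι b)            ∎)

  ι-mono : ∀ {a b} → a ℤ.≤ b → ι a ≤ ι b
  ι-mono {a} {b} a≤b = toℚᵘ-cancel-≤
    (ℚᵘ.≤-respˡ-≃ (ℚᵘ.≃-sym (toℚᵘ-ι a)) (ℚᵘ.≤-respʳ-≃ (ℚᵘ.≃-sym (toℚᵘ-ι b))
      (ℚᵘ.*≤* (ℤ.*-monoʳ-≤-nonNeg (+ 1) a≤b))))

  ι-cancel : ∀ {a b} → ι a ≤ ι b → a ℤ.≤ b
  ι-cancel {a} {b} ιa≤ιb with ℚᵘ.≤-respˡ-≃ (toℚᵘ-ι a) (ℚᵘ.≤-respʳ-≃ (toℚᵘ-ι b) (toℚᵘ-mono-≤ ιa≤ιb))
  ... | ℚᵘ.*≤* a*1≤b*1 = ℤ.*-cancelʳ-≤-pos a b (+ 1) a*1≤b*1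

  ι-nonNeg : ∀ n → NonNegative (ι (+ n))
  ι-nonNeg n = normalize-nonNeg n 1

module Maxima where
  open import Data.Rational using (_≤_; _⊔_)
  open import Data.Rational.Properties using (≤-refl; ≤-trans; ⊔-lub; p≤p⊔q; p≤q⊔p; ⊔-sel)
  open import Data.List using ([]; _∷_)
  open import Data.List.NonEmpty using (List⁺; _∷_; toList; foldr₁; map)
  open import Data.List.Membership.Propositional using (_∈_)
  open import Data.List.Membership.Propositional.Properties using (∈-map⁺; ∈-map⁻)
  open import Data.List.Relation.Unary.Any using (here; there)
  open import Data.Product using (∃; _×_; _,_)
  open import Data.Sum using (inj₁; inj₂)
  open import Relation.Binary.PropositionalEquality

  max-ub : ∀ v ws {u} → u ∈ v ∷ ws → u ≤ foldr₁ _⊔_ (v ∷ ws)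
  max-ub v []       (here refl) = ≤-refl
  max-ub v (w ∷ ws) (here refl) = p≤p⊔q v _
  max-ub v (w ∷ ws) (there u∈)  = ≤-trans (max-ub w ws u∈) (p≤q⊔p v _)

  max-lub : ∀ v ws {c} → (∀ {u} → u ∈ v ∷ ws → u ≤ c) → foldr₁ _⊔_ (v ∷ ws) ≤ c
  max-lub v []       all≤c = all≤c (here refl)
  max-lub v (w ∷ ws) all≤c = ⊔-lub (all≤c (here refl)) (max-lub w ws (λ u∈ → all≤c (there u∈)))

  max-sel : ∀ v ws → foldr₁ _⊔_ (v ∷ ws) ∈ v ∷ ws
  max-sel v []       = here refl
  max-sel v (w ∷ ws) with ⊔-sel v (foldr₁ _⊔_ (w ∷ ws))
  ... | inj₁ max≡v    = here max≡v
  ... | inj₂ max≡rest = there (subst (_∈ w ∷ ws) (sym max≡rest) (max-sel w ws))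

  maxAff-ub : ∀ (hs : List⁺ Affine) {h} x y → h ∈ toList hs → evalAff h x y ≤ maxAff hs x y
  maxAff-ub (h ∷ hs) x y h∈ = max-ub (evalAff h x y) _ (∈-map⁺ (λ g → evalAff g x y) h∈)

  maxAff-lub : ∀ (hs : List⁺ Affine) x y {c} → (∀ {h} → h ∈ toList hs → evalAff h x y ≤ c) →
               maxAff hs x y ≤ c
  maxAff-lub (h ∷ hs) x y {c} all≤c = max-lub (evalAff h x y) _ value≤c
    where
    value≤c : ∀ {v} → v ∈ toList (map (λ g → evalAff g x y) (h ∷ hs)) → v ≤ c
    value≤c v∈ with ∈-map⁻ (λ g → evalAff g x y) v∈
    ... | g , g∈ , refl = all≤c g∈

  maxAff-sel : ∀ (hs : List⁺ Affine) x y → ∃ λ h → h ∈ toList hs × maxAff hs x y ≡ evalAff h x y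
  maxAff-sel (h ∷ hs) x y = ∈-map⁻ (λ g → evalAff g x y) (max-sel (evalAff h x y) _)

module AffinePieces where
  import Data.Nat.Properties as ℕₚ
  open import Data.Integer as ℤ using (ℤ; +_)
  import Data.Integer.Properties as ℤ
  open import Data.Rational using (_≤_; _+_; _*_; NonNegative)
  open import Data.Rational.Properties using (≤-trans; +-mono-≤; +-monoˡ-≤; *-monoˡ-≤-nonNeg)
  open import Data.List.NonEmpty using (List⁺; toList)
  open import Data.List.Membership.Propositional using (_∈_)
  open import Data.Product using (∃; _×_; _,_)
  open import Relation.Binary.PropositionalEquality
  open ≡-Reasoning
  open Embedding
  open Maxima

  MonotoneAff : Affine → Set
  MonotoneAff (aff a b c) = NonNegative a × NonNegative b

  evalAff-mono : ∀ h → MonotoneAff h → ∀ {x y x′ y′} → x ≤ x′ → y ≤ y′ →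
                 evalAff h x y ≤ evalAff h x′ y′
  evalAff-mono (aff a b c) (a≥0 , b≥0) x≤x′ y≤y′ =
    +-monoˡ-≤ c (+-mono-≤ (*-monoˡ-≤-nonNeg a {{a≥0}} x≤x′) (*-monoˡ-≤-nonNeg b {{b≥0}} y≤y′))

  maxAff-mono : ∀ (hs : List⁺ Affine) → (∀ {h} → h ∈ toList hs → MonotoneAff h) →
                ∀ {x y x′ y′} → x ≤ x′ → y ≤ y′ → maxAff hs x y ≤ maxAff hs x′ y′
  maxAff-mono hs mono x≤x′ y≤y′ = maxAff-lub hs _ _ (λ {h} h∈ →
    ≤-trans (evalAff-mono h (mono h∈) x≤x′ y≤y′) (maxAff-ub hs _ _ h∈))

  intAff : ℤ → ℤ → ℤ → Affine
  intAff a b c = aff (ι a) (ι b) (ι c)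

  evalAff-intAff : ∀ a b c i j →
                   evalAff (intAff a b c) (ι i) (ι j) ≡ ι (a ℤ.* i ℤ.+ b ℤ.* j ℤ.+ c)
  evalAff-intAff a b c i j = begin
    ι a * ι i + ι b * ι j + ι c       ≡⟨ cong₂ (λ u v → u + v + ι c) (ι-* a i) (ι-* b j) ⟨
    ι (a ℤ.* i) + ι (b ℤ.* j) + ι c   ≡⟨ cong (_+ ι c) (ι-+ (a ℤ.* i) (b ℤ.* j)) ⟨
    ι (a ℤ.* i ℤ.+ b ℤ.* j) + ι c     ≡⟨ ι-+ (a ℤ.* i ℤ.+ b ℤ.* j) c ⟨
    ι (a ℤ.* i ℤ.+ b ℤ.* j ℤ.+ c)     ∎

  IntegralAff : Affine → Set
  IntegralAff h = ∃ λ a → ∃ λ b → ∃ λ c → h ≡ intAff a b c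

  maxAff-integral : ∀ (hs : List⁺ Affine) → (∀ {h} → h ∈ toList hs → IntegralAff h) →
                    ∀ i j → ∃ λ z → maxAff hs (ι i) (ι j) ≡ ι z
  maxAff-integral hs integral i j with maxAff-sel hs (ι i) (ι j)
  ... | h , h∈ , max≡h with integral h∈
  ... | a , b , c , refl = a ℤ.* i ℤ.+ b ℤ.* j ℤ.+ c , trans max≡h (evalAff-intAff a b c i j)

  integral-gap : ∀ A z → ⟦ A ⟧ ≤ ι z → ι z ≢ ⟦ A ⟧ → ⟦ A ℕ.+ 1 ⟧ ≤ ι z
  integral-gap A z A≤z z≢A = ι-mono (subst (ℤ._≤ z) (cong +_ (ℕₚ.+-comm 1 A))
    (ℤ.i<j⇒suc[i]≤j (ℤ.≤∧≢⇒< (ι-cancel {+ A} A≤z) (λ A≡z → z≢A (cong ι (sym A≡z))))))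

  maxAff-gap : ∀ U A (hs : List⁺ Affine) → (∀ {h} → h ∈ toList hs → IntegralAff h) →
               (∀ i j → ⟦ A ⟧ ≤ maxAff hs ⟦ i ⟧ ⟦ j ⟧) → GapOK U A (maxAff hs)
  maxAff-gap U A hs integral A≤max i j _ max≢A with maxAff-integral hs integral (+ i) (+ j)
  ... | z , max≡z = subst (⟦ A ℕ.+ 1 ⟧ ≤_) (sym max≡z)
    (integral-gap A z (subst (⟦ A ⟧ ≤_) max≡z (A≤max i j)) (λ z≡A → max≢A (trans max≡z z≡A)))

module BitVectors where
  open ℕ using (zero; suc; _^_)
  open import Data.Fin using (Fin; zero; suc; finToFun; funToFin; combine)
  open import Data.Fin.Properties using (funToFin-finToFin)
  open import Relation.Binary.PropositionalEquality

  funToFin-cong : ∀ {m n} {f g : Fin m → Fin n} → (∀ i → f i ≡ g i) → funToFin f ≡ funToFin g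
  funToFin-cong {zero}  f≗g = refl
  funToFin-cong {suc m} f≗g = cong₂ combine (f≗g zero) (funToFin-cong (λ i → f≗g (suc i)))

  finToFun-injective : ∀ {m n} (x y : Fin (n ^ m)) →
                       (∀ i → finToFun {n} {m} x i ≡ finToFun y i) → x ≡ y
  finToFun-injective {m} {n} x y same = begin
    x                                     ≡⟨ funToFin-finToFin {m} {n} x ⟨
    funToFin {m} {n} (finToFun x)         ≡⟨ funToFin-cong same ⟩
    funToFin {m} {n} (finToFun y)         ≡⟨ funToFin-finToFin {m} {n} y ⟩
    y                                     ∎
    where open ≡-Reasoning

  bit-ext : ∀ (u v : Fin 2) → (u ≡ suc zero → v ≡ suc zero) → (v ≡ suc zero → u ≡ suc zero) → u ≡ v
  bit-ext zero       zero       _ _ = refl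
  bit-ext zero       (suc zero) _ v⇒u = v⇒u refl
  bit-ext (suc zero) zero       u⇒v _ = sym (u⇒v refl)
  bit-ext (suc zero) (suc zero) _ _ = refl

module PieceArithmetic where
  open import Data.Integer
  open import Data.Integer.Tactic.RingSolver using (solve-∀)
  open import Relation.Binary.PropositionalEquality

  -- constant term of the k-th piece x + k y + offset; A, U, m are the parameters
  -- of the construction and d ∈ {0, 1} is the bit attached to the piece
  offset : ℤ → ℤ → ℤ → ℤ → ℤ → ℤ
  offset A U m k d = A + 1ℤ + + 2 * k * m - (k + 1ℤ) * U - k * k - d

  offset-corner : ∀ A U m k d →
    1ℤ * U + k * U + offset A U m k d ≡ A + 1ℤ + m * m - ((m - k) * (m - k) + d)
  offset-corner = corner
    -- the ring solver needs offset unfolded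
    where
    corner : ∀ A U m k d → 1ℤ * U + k * U + (A + 1ℤ + + 2 * k * m - (k + 1ℤ) * U - k * k - d)
                           ≡ A + 1ℤ + m * m - ((m - k) * (m - k) + d)
    corner = solve-∀

  offset-witness : ∀ A U m k t d →
    1ℤ * (U - t * t) + k * (U - + 2 * (m - t)) + offset A U m k d ≡ A + 1ℤ - ((k - t) * (k - t) + d)
  offset-witness = witness
    -- the ring solver needs offset unfolded
    where
    witness : ∀ A U m k t d →
      1ℤ * (U - t * t) + k * (U - + 2 * (m - t)) + (A + 1ℤ + + 2 * k * m - (k + 1ℤ) * U - k * k - d)
      ≡ A + 1ℤ - ((k - t) * (k - t) + d)
    witness = solve-∀

  witness-diagonal : ∀ a t → a + 1ℤ - ((t - t) * (t - t) + 0ℤ) ≡ a + 1ℤ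
  witness-diagonal = solve-∀

module Construction (U A m : ℕ.ℕ) (hU : ℕ.suc m ℕ.* ℕ.suc m ℕ.≤ U) where
  open ℕ using (ℕ; suc; _∸_; z≤n; s≤s)
  import Data.Nat.Properties as ℕₚ
  import Data.Nat.Tactic.RingSolver as ℕ-Solver
  open import Data.Integer as ℤ using (ℤ; +_; 0ℤ; 1ℤ; +≤+)
  import Data.Integer.Properties as ℤₚ
  import Data.Rational as ℚ
  import Data.Rational.Properties as ℚₚ
  open import Data.Fin using (Fin; zero; suc; toℕ; _≟_)
  import Data.Fin.Properties as Finₚ
  open import Data.List as List using (allFin)
  open import Data.List.Properties using (length-map; length-tabulate)
  open import Data.List.NonEmpty using (List⁺; _∷_; toList; length)
  open import Data.List.Membership.Propositional using (_∈_)
  open import Data.List.Membership.Propositional.Properties using (∈-map⁺; ∈-map⁻; ∈-allFin)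
  open import Data.List.Relation.Unary.Any using (here; there)
  open import Data.Product using (_,_; proj₁; proj₂)
  open import Data.Empty using (⊥-elim)
  open import Relation.Nullary using (yes; no)
  open import Relation.Binary.PropositionalEquality
  open IntegerFacts
  open Embedding
  open Maxima
  open AffinePieces
  open PieceArithmetic
  open BitVectors using (bit-ext)

  Bits : Set
  Bits = Fin (suc m) → Fin 2

  κ : Fin (suc m) → ℤ
  κ k = + toℕ k

  bit : Fin 2 → ℤ
  bit u = + toℕ u

  base : Affine
  base = intAff 0ℤ 0ℤ (+ A)

  piece : Bits → Fin (suc m) → Affine
  piece β k = intAff 1ℤ (κ k) (offset (+ A) (+ U) (+ m) (κ k) (bit (β k)))

  family : Bits → List⁺ Affine
  family β = base ∷ List.map (piece β) (allFin (suc m))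

  family-all : ∀ (P : Affine → Set) β → P base → (∀ k → P (piece β k)) →
               ∀ {h} → h ∈ toList (family β) → P h
  family-all P β P-base P-piece (here refl) = P-base
  family-all P β P-base P-piece (there h∈) with ∈-map⁻ (piece β) {xs = allFin (suc m)} h∈
  ... | k , _ , refl = P-piece k

  piece∈family : ∀ β k → piece β k ∈ toList (family β)
  piece∈family β k = there (∈-map⁺ (piece β) (∈-allFin k))

  family-length : ∀ β → length (family β) ℕ.≤ 2 ℕ.* suc m
  family-length β = begin
    length (family β)                          ≡⟨ cong suc (length-map (piece β) (allFin (suc m))) ⟩
    suc (List.length (allFin (suc m)))         ≡⟨ cong suc (length-tabulate (λ k → k)) ⟩
    suc (suc m)                                ≤⟨ ℕₚ.m≤m+n (suc (suc m)) m ⟩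
    suc (suc m) ℕ.+ m                          ≡⟨ double m ⟨
    2 ℕ.* suc m                                ∎
    where
    open ℕₚ.≤-Reasoning
    double : ∀ n → 2 ℕ.* suc n ≡ suc (suc n) ℕ.+ n
    double = ℕ-Solver.solve-∀

  family-integral : ∀ β {h} → h ∈ toList (family β) → IntegralAff h
  family-integral β = family-all IntegralAff β (0ℤ , 0ℤ , + A , refl)
    (λ k → 1ℤ , κ k , offset (+ A) (+ U) (+ m) (κ k) (bit (β k)) , refl)

  family-monotone : ∀ β {h} → h ∈ toList (family β) → MonotoneAff h
  family-monotone β =
    family-all MonotoneAff β (ι-nonNeg 0 , ι-nonNeg 0) (λ k → ι-nonNeg 1 , ι-nonNeg (toℕ k))

  square-succ : suc m ℕ.* suc m ≡ suc (m ℕ.* m ℕ.+ 2 ℕ.* m)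
  square-succ = expand m
    where
    expand : ∀ n → suc n ℕ.* suc n ≡ suc (n ℕ.* n ℕ.+ 2 ℕ.* n)
    expand = ℕ-Solver.solve-∀

  m²<U : m ℕ.* m ℕ.< U
  m²<U = ℕₚ.≤-trans (s≤s (ℕₚ.m≤m+n (m ℕ.* m) (2 ℕ.* m))) (subst (ℕ._≤ U) square-succ hU)

  2m<U : 2 ℕ.* m ℕ.< U
  2m<U = ℕₚ.≤-trans (s≤s (ℕₚ.m≤n+m (2 ℕ.* m) (m ℕ.* m))) (subst (ℕ._≤ U) square-succ hU)

  base-value : ∀ x y → evalAff base x y ≡ ⟦ A ⟧
  base-value x y = begin
    ℚ.0ℚ ℚ.* x ℚ.+ ℚ.0ℚ ℚ.* y ℚ.+ ⟦ A ⟧  ≡⟨ cong (ℚ._+ ⟦ A ⟧) (cong₂ ℚ._+_ (ℚₚ.*-zeroˡ x) (ℚₚ.*-zeroˡ y)) ⟩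
    ℚ.0ℚ ℚ.+ ℚ.0ℚ ℚ.+ ⟦ A ⟧               ≡⟨ cong (ℚ._+ ⟦ A ⟧) (ℚₚ.+-identityˡ ℚ.0ℚ) ⟩
    ℚ.0ℚ ℚ.+ ⟦ A ⟧                       ≡⟨ ℚₚ.+-identityˡ ⟦ A ⟧ ⟩
    ⟦ A ⟧                                ∎
    where open ≡-Reasoning

  A≤family : ∀ β x y → ⟦ A ⟧ ℚ.≤ maxAff (family β) x y
  A≤family β x y =
    subst (ℚ._≤ maxAff (family β) x y) (base-value x y) (maxAff-ub (family β) x y (here refl))

  -- every piece is at most A + U at the corner (U , U), since 2km − k² ≤ m² < U
  corner-bound : ∀ β k → evalAff (piece β k) ⟦ U ⟧ ⟦ U ⟧ ℚ.≤ ⟦ A ℕ.+ U ⟧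
  corner-bound β k =
    subst (ℚ._≤ ⟦ A ℕ.+ U ⟧) (sym (evalAff-intAff 1ℤ (κ k) off (+ U) (+ U))) (ι-mono (begin
    1ℤ ℤ.* + U ℤ.+ κ k ℤ.* + U ℤ.+ off
      ≡⟨ offset-corner (+ A) (+ U) (+ m) (κ k) d ⟩
    + A ℤ.+ 1ℤ ℤ.+ + m ℤ.* + m ℤ.- (excess ℤ.* excess ℤ.+ d)
      ≤⟨ minus-nonNeg _ _ (ℤₚ.+-mono-≤ (square-nonNeg excess) (+≤+ z≤n)) ⟩
    + A ℤ.+ 1ℤ ℤ.+ + m ℤ.* + m
      ≡⟨ cong (λ z → + (A ℕ.+ 1) ℤ.+ z) (ℤₚ.pos-* m m) ⟨
    + (A ℕ.+ 1 ℕ.+ m ℕ.* m)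
      ≤⟨ +≤+ (subst (ℕ._≤ A ℕ.+ U) (sym (ℕₚ.+-assoc A 1 (m ℕ.* m))) (ℕₚ.+-monoʳ-≤ A m²<U)) ⟩
    + (A ℕ.+ U) ∎))
    where
    open ℤₚ.≤-Reasoning
    d = bit (β k)
    off = offset (+ A) (+ U) (+ m) (κ k) d
    excess = + m ℤ.- κ k

  -- the three pointwise properties: range [A, A+U] on the box (by monotonicity the
  -- corner bound suffices), monotonicity, and the gap above A on the grid
  family-range : ∀ β → RangeOK U A (maxAff (family β))
  family-range β x y ((_ , x≤U) , (_ , y≤U)) =
    A≤family β x y ,
    maxAff-lub (family β) x y (family-all (λ h → evalAff h x y ℚ.≤ ⟦ A ℕ.+ U ⟧) β base-bound piece-bound)
    where
    base-bound : evalAff base x y ℚ.≤ ⟦ A ℕ.+ U ⟧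
    base-bound = subst (ℚ._≤ ⟦ A ℕ.+ U ⟧) (sym (base-value x y)) (ι-mono (+≤+ (ℕₚ.m≤m+n A U)))
    piece-bound : ∀ k → evalAff (piece β k) x y ℚ.≤ ⟦ A ℕ.+ U ⟧
    piece-bound k = ℚₚ.≤-trans (evalAff-mono (piece β k) (family-monotone β (piece∈family β k)) x≤U y≤U)
                               (corner-bound β k)

  family-nondecreasing : ∀ β → Nondecreasing U (maxAff (family β))
  family-nondecreasing β x y x′ y′ _ _ = maxAff-mono (family β) (family-monotone β)

  family-gap : ∀ β → GapOK U A (maxAff (family β))
  family-gap β = maxAff-gap U A (family β) (family-integral β) (λ i j → A≤family β ⟦ i ⟧ ⟦ j ⟧)

  -- the witness point of index t; the zero set of family β contains it iff β t = 1
  wx wy : Fin (suc m) → ℕ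
  wx t = U ∸ toℕ t ℕ.* toℕ t
  wy t = U ∸ 2 ℕ.* (m ∸ toℕ t)

  t≤m : ∀ (t : Fin (suc m)) → toℕ t ℕ.≤ m
  t≤m t = ℕₚ.≤-pred (Finₚ.toℕ<n t)

  t²<U : ∀ (t : Fin (suc m)) → toℕ t ℕ.* toℕ t ℕ.< U
  t²<U t = ℕₚ.≤-<-trans (ℕₚ.*-mono-≤ (t≤m t) (t≤m t)) m²<U

  2[m-t]<U : ∀ (t : Fin (suc m)) → 2 ℕ.* (m ∸ toℕ t) ℕ.< U
  2[m-t]<U t = ℕₚ.≤-<-trans (ℕₚ.*-monoʳ-≤ 2 (ℕₚ.m∸n≤m m (toℕ t))) 2m<U

  witness-grid : ∀ (t : Fin (suc m)) → InGrid U (wx t) (wy t)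
  witness-grid t = (ℕₚ.m<n⇒0<n∸m (t²<U t) , ℕₚ.m∸n≤m U (toℕ t ℕ.* toℕ t))
                 , (ℕₚ.m<n⇒0<n∸m (2[m-t]<U t) , ℕₚ.m∸n≤m U (2 ℕ.* (m ∸ toℕ t)))

  wx-cast : ∀ (t : Fin (suc m)) → + wx t ≡ + U ℤ.- κ t ℤ.* κ t
  wx-cast t = trans (pos-∸ (ℕₚ.<⇒≤ (t²<U t))) (cong (λ z → + U ℤ.- z) (ℤₚ.pos-* (toℕ t) (toℕ t)))

  wy-cast : ∀ (t : Fin (suc m)) → + wy t ≡ + U ℤ.- + 2 ℤ.* (+ m ℤ.- κ t)
  wy-cast t = trans (pos-∸ (ℕₚ.<⇒≤ (2[m-t]<U t)))
    (cong (λ z → + U ℤ.- z) (trans (ℤₚ.pos-* 2 (m ∸ toℕ t)) (cong (λ z → + 2 ℤ.* z) (pos-∸ (t≤m t)))))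

  witness-value : ∀ β t k → evalAff (piece β k) ⟦ wx t ⟧ ⟦ wy t ⟧
                  ≡ ι (+ A ℤ.+ 1ℤ ℤ.- ((κ k ℤ.- κ t) ℤ.* (κ k ℤ.- κ t) ℤ.+ bit (β k)))
  witness-value β t k = trans (evalAff-intAff 1ℤ (κ k) off (+ wx t) (+ wy t)) (cong ι (begin
    1ℤ ℤ.* + wx t ℤ.+ κ k ℤ.* + wy t ℤ.+ off
      ≡⟨ cong₂ (λ u v → 1ℤ ℤ.* u ℤ.+ κ k ℤ.* v ℤ.+ off) (wx-cast t) (wy-cast t) ⟩
    1ℤ ℤ.* (+ U ℤ.- κ t ℤ.* κ t) ℤ.+ κ k ℤ.* (+ U ℤ.- + 2 ℤ.* (+ m ℤ.- κ t)) ℤ.+ off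
      ≡⟨ offset-witness (+ A) (+ U) (+ m) (κ k) (κ t) (bit (β k)) ⟩
    + A ℤ.+ 1ℤ ℤ.- ((κ k ℤ.- κ t) ℤ.* (κ k ℤ.- κ t) ℤ.+ bit (β k)) ∎))
    where
    open ≡-Reasoning
    off = offset (+ A) (+ U) (+ m) (κ k) (bit (β k))

  κ-injective : ∀ {k t} → k ≢ t → κ k ℤ.- κ t ≢ 0ℤ
  κ-injective k≢t k-t≡0 = k≢t (Finₚ.toℕ-injective (ℤₚ.+-injective (ℤₚ.i-j≡0⇒i≡j _ _ k-t≡0)))

  -- if β t = 1, every piece is ≤ A at the witness: the square (k − t)² or the bit is ≥ 1
  bit-one⇒zero : ∀ β t → β t ≡ suc zero → maxAff (family β) ⟦ wx t ⟧ ⟦ wy t ⟧ ≡ ⟦ A ⟧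
  bit-one⇒zero β t βt≡1 = ℚₚ.≤-antisym
    (maxAff-lub (family β) ⟦ wx t ⟧ ⟦ wy t ⟧
      (family-all (λ h → evalAff h ⟦ wx t ⟧ ⟦ wy t ⟧ ℚ.≤ ⟦ A ⟧) β
        (ℚₚ.≤-reflexive (base-value ⟦ wx t ⟧ ⟦ wy t ⟧)) piece≤A))
    (A≤family β ⟦ wx t ⟧ ⟦ wy t ⟧)
    where
    excess : ∀ k → 1ℤ ℤ.≤ (κ k ℤ.- κ t) ℤ.* (κ k ℤ.- κ t) ℤ.+ bit (β k)
    excess k with k ≟ t
    ... | yes refl = ℤₚ.+-mono-≤ (square-nonNeg (κ k ℤ.- κ k)) (ℤₚ.≤-reflexive (cong bit (sym βt≡1)))
    ... | no k≢t   = ℤₚ.+-mono-≤ (square-pos (κ k ℤ.- κ t) (κ-injective k≢t)) (+≤+ z≤n)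
    piece≤A : ∀ k → evalAff (piece β k) ⟦ wx t ⟧ ⟦ wy t ⟧ ℚ.≤ ⟦ A ⟧
    piece≤A k = subst (ℚ._≤ ⟦ A ⟧) (sym (witness-value β t k)) (ι-mono (succ-minus-pos (+ A) _ (excess k)))

  -- if β t = 0, the t-th piece takes the value A + 1 at the witness
  bit-zero⇒nonzero : ∀ β t → β t ≡ zero → maxAff (family β) ⟦ wx t ⟧ ⟦ wy t ⟧ ≢ ⟦ A ⟧
  bit-zero⇒nonzero β t βt≡0 max≡A =
    ℕₚ.m+1+n≰m A (ℤₚ.drop‿+≤+ (ι-cancel (subst (⟦ A ℕ.+ 1 ⟧ ℚ.≤_) max≡A A+1≤max)))
    where
    piece-value : evalAff (piece β t) ⟦ wx t ⟧ ⟦ wy t ⟧ ≡ ⟦ A ℕ.+ 1 ⟧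
    piece-value = trans (witness-value β t t)
      (cong ι (trans (cong (λ d → + A ℤ.+ 1ℤ ℤ.- ((κ t ℤ.- κ t) ℤ.* (κ t ℤ.- κ t) ℤ.+ bit d)) βt≡0)
                     (witness-diagonal (+ A) (κ t))))
    A+1≤max : ⟦ A ℕ.+ 1 ⟧ ℚ.≤ maxAff (family β) ⟦ wx t ⟧ ⟦ wy t ⟧
    A+1≤max = subst (ℚ._≤ maxAff (family β) ⟦ wx t ⟧ ⟦ wy t ⟧) piece-value
                    (maxAff-ub (family β) ⟦ wx t ⟧ ⟦ wy t ⟧ (piece∈family β t))

  zero⇒bit-one : ∀ β t → maxAff (family β) ⟦ wx t ⟧ ⟦ wy t ⟧ ≡ ⟦ A ⟧ → β t ≡ suc zero
  zero⇒bit-one β t max≡A with β t in βt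
  ... | zero     = ⊥-elim (bit-zero⇒nonzero β t βt max≡A)
  ... | suc zero = refl

  same-zero-set⇒same-bits : ∀ β γ → SameZeroSet U A (maxAff (family β)) (maxAff (family γ)) →
                            ∀ t → β t ≡ γ t
  same-zero-set⇒same-bits β γ same t = bit-ext (β t) (γ t)
    (λ βt≡1 → zero⇒bit-one γ t (proj₁ (same (wx t) (wy t) (witness-grid t)) (bit-one⇒zero β t βt≡1)))
    (λ γt≡1 → zero⇒bit-one β t (proj₂ (same (wx t) (wy t) (witness-grid t)) (bit-one⇒zero γ t γt≡1)))

open import Data.Nat using (ℕ; suc; _*_; _^_; _≤_; _<_)
open import Data.Nat.Properties using (≤⇒≯; m≤m+n)
open import Data.Fin using (Fin; finToFun)
open import Data.List.NonEmpty using (List⁺; length)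
open import Data.Product using (Σ; _×_; _,_)
open import Data.Empty using (⊥-elim)
open import Relation.Nullary using (¬_)
open import Relation.Binary.PropositionalEquality using (_≢_)

-- Take c = 0 and C = 2. Since 1 ≤ U < (s + 1)², s = m + 1 for some m; the family has
-- one member per element b of Fin (2 ^ s), built from the bit vector of b.
theorem3p1 : Σ ℕ λ c → Σ ℕ λ C →
    ∀ (U : ℕ) → 1 ≤ U → ∀ (s : ℕ) → s * s ≤ U → U < suc s * suc s →
    ∀ (A : ℕ) → Σ ℕ λ L → (2 ^ s ≤ suc c * L) ×
    Σ (Fin L → List⁺ Affine) λ fam →
    (∀ k → length (fam k) ≤ C * s) ×
    (∀ k → RangeOK U A (maxAff (fam k))) ×
    (∀ k → Nondecreasing U (maxAff (fam k))) ×
    (∀ k → GapOK U A (maxAff (fam k))) ×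
    (∀ k l → k ≢ l → ¬ SameZeroSet U A (maxAff (fam k)) (maxAff (fam l)))
theorem3p1 = 0 , 2 , λ where
  U 1≤U 0       _  U<1 A → ⊥-elim (≤⇒≯ 1≤U U<1)
  U _   (suc m) hU _   A → let open Construction U A m hU in
    2 ^ suc m , m≤m+n (2 ^ suc m) 0 ,
    (λ b → family (finToFun b)) ,
    (λ b → family-length (finToFun b)) ,
    (λ b → family-range (finToFun b)) ,
    (λ b → family-nondecreasing (finToFun b)) ,
    (λ b → family-gap (finToFun b)) ,
    λ b b′ b≢b′ same → b≢b′ (BitVectors.finToFun-injective b b′
                                (same-zero-set⇒same-bits (finToFun b) (finToFun b′) same))
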